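{- Let $p$ be an odd prime. Let $n(p)$ be the least positive integer that is not a quadratic residue modulo $p$ (equivalently, the largest integer $0\le n<p$ such that every element of $\{0,\ldots,n-1\}$ is a square modulo $p$). Let $L(p)$ be the smallest integer $L$ with $2\le L\le p-1$ such that the only map $f:\{0,\ldots,L\}\to\mathbb{F}_p$ satisfying $$f(0)=0,\quad f(1)=1,\quad \frac{f(x)-f(y)}{x-y}\in\mathbb{F}_p^2\ \text{ for all } x\neq y\in\{0,\ldots,L\}$$ is $f(j)=j$. Then $n(p)\le L(p)$.
   Context: $\mathbb{F}_p^2$ denotes the set of squares in $\mathbb{F}_p$ (including $0$); $0$ counts as a square modulo $p$. Integers $0,\ldots,L$ are viewed in $\mathbb{F}_p$. Such an $L(p)$ exists since for $L=p-1$ the identity is the only solution. -}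

module Defs where

open import Data.Nat using (ℕ; zero; suc; _+_; _*_; _∸_; _≤_; _<_; NonZero)
open import Data.Nat.DivMod using (_%_)
open import Data.Fin using (Fin; toℕ)
open import Data.Product using (Σ; ∃; _×_)
open import Relation.Binary.PropositionalEquality using (_≡_)
open import Relation.Nullary using (¬_)

CongMod : (p : ℕ) → .{{NonZero p}} → ℕ → ℕ → Set
CongMod p a b = a % p ≡ b % p

-- a is a square in 𝔽_p (0 counts as a square).
IsSquare : (p : ℕ) → .{{NonZero p}} → ℕ → Set
IsSquare p a = Σ ℕ λ y → CongMod p (y * y) a

IsLeastNonResidue : (p : ℕ) → .{{NonZero p}} → ℕ → Set
IsLeastNonResidue p n =
  1 ≤ n × ¬ IsSquare p n × (∀ m → 1 ≤ m → m < n → IsSquare p m)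

-- For x ≠ y in 𝔽_p, the quotient (a - b)/(x - y) is the unique q with
-- q * (x - y) = a - b in 𝔽_p, i.e. q * x + b ≡ q * y + a (mod p).
QuotientIsSquare : (p : ℕ) → .{{NonZero p}} → (a b x y : ℕ) → Set
QuotientIsSquare p a b x y =
  Σ ℕ λ q → CongMod p (q * x + b) (q * y + a) × IsSquare p q

Admissible : (p : ℕ) → .{{NonZero p}} → (L : ℕ) → (Fin (suc L) → Fin p) → Set
Admissible p L f =
  (∀ x → toℕ x ≡ 0 → toℕ (f x) ≡ 0) ×
  (∀ x → toℕ x ≡ 1 → toℕ (f x) ≡ 1) ×
  (∀ x y → ¬ (toℕ x ≡ toℕ y) →
     QuotientIsSquare p (toℕ (f x)) (toℕ (f y)) (toℕ x) (toℕ y))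

OnlyIdentity : (p : ℕ) → .{{NonZero p}} → ℕ → Set
OnlyIdentity p L =
  ∀ (f : Fin (suc L) → Fin p) → Admissible p L f → ∀ j → toℕ (f j) ≡ toℕ j

IsLp : (p : ℕ) → .{{NonZero p}} → ℕ → Set
IsLp p L =
  2 ≤ L × L ≤ p ∸ 1 × OnlyIdentity p L ×
  (∀ L′ → 2 ≤ L′ → L′ < L → ¬ OnlyIdentity p L′)

module Submission where

-- If L < n(p), then every integer 1,…,L is a nonzero square modulo p.  Since
-- the inverse of a nonzero square is again a square, the step map
--   f(0) = 0,  f(x) = 1  for 1 ≤ x ≤ L
-- has only square difference quotients: (1 - 0)/(x - 0) = x⁻¹ and
-- (1 - 1)/(x - y) = 0.  It is therefore admissible, yet f(2) = 1 ≠ 2, so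
-- L does not have the "only the identity" property.  As L(p) does have it,
-- L(p) < n(p) is impossible, i.e. n(p) ≤ L(p).

open import Defs
open import Data.Nat using (ℕ; zero; suc; _+_; _*_; _≤_; _<_; _≤?_; z≤n; s≤s; NonZero)
open import Data.Nat.Properties
  using (+-identityʳ; *-zeroʳ; ≤-trans; ≤-<-trans; ≤-pred; ≰⇒>)
open import Data.Nat.DivMod using (_%_; [m+kn]%n≡m%n; %-distribˡ-*)
open import Data.Nat.Primality using (Prime; ¬prime[0]; ¬prime[1])
open import Data.Nat.Coprimality using (prime⇒coprime; coprime-Bézout)
import Data.Nat.Coprimality as Coprimality
open import Data.Nat.GCD using (module Bézout)
open import Data.Nat.Solver using (module +-*-Solver)
open +-*-Solver using (solve; _:+_; _:*_; _:=_; con)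
open import Data.Fin using (Fin; toℕ; fromℕ<) renaming (zero to fzero; suc to fsuc)
open import Data.Fin.Properties using (toℕ<n; toℕ-fromℕ<)
open import Data.Product using (Σ; _,_; _×_)
open import Data.Empty using (⊥-elim)
open import Relation.Nullary using (¬_; yes; no)
open import Relation.Binary.PropositionalEquality
  using (_≡_; _≢_; refl; sym; trans; cong; cong₂; subst₂; module ≡-Reasoning)

HasSquareInverse : (p : ℕ) → .{{NonZero p}} → ℕ → Set
HasSquareInverse p x = Σ ℕ λ q → CongMod p (q * x) 1 × IsSquare p q

*-congˡ-mod : ∀ p .{{_ : NonZero p}} c {a b} → CongMod p a b → CongMod p (c * a) (c * b)
*-congˡ-mod p c {a} {b} a≡b = begin
  (c * a) % p              ≡⟨ %-distribˡ-* c a p ⟩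
  ((c % p) * (a % p)) % p  ≡⟨ cong (λ t → ((c % p) * t) % p) a≡b ⟩
  ((c % p) * (b % p)) % p  ≡⟨ %-distribˡ-* c b p ⟨
  (c * b) % p              ∎
  where open ≡-Reasoning

*-cong-mod : ∀ p .{{_ : NonZero p}} {a b c d} →
  CongMod p a b → CongMod p c d → CongMod p (a * c) (b * d)
*-cong-mod p {a} {b} {c} {d} a≡b c≡d = begin
  (a * c) % p              ≡⟨ %-distribˡ-* a c p ⟩
  ((a % p) * (c % p)) % p  ≡⟨ cong₂ (λ s t → (s * t) % p) a≡b c≡d ⟩
  ((b % p) * (d % p)) % p  ≡⟨ %-distribˡ-* b d p ⟨
  (b * d) % p              ∎
  where open ≡-Reasoning

-- Every x with 0 < x < p has an inverse modulo a prime p.  Bézout gives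
-- a·x ≡ 1 or a·x ≡ -1 (mod p); in the second case -a ≡ a·(p - 1) is the inverse.
inverse-mod-prime : ∀ p .{{_ : NonZero p}} → Prime p → ∀ x → 0 < x → x < p →
  Σ ℕ λ u → CongMod p (u * x) 1
inverse-mod-prime zero ()
inverse-mod-prime p@(suc k) p-prime x@(suc _) _ x<p
  with coprime-Bézout (Coprimality.sym (prime⇒coprime p-prime x<p))
... | Bézout.+- a b 1+bp≡ax =
  a , trans (cong (_% p) (sym 1+bp≡ax)) ([m+kn]%n≡m%n 1 b p)
... | Bézout.-+ a b 1+ax≡bp = a * k , (begin
  (a * k * x) % p            ≡⟨ [m+kn]%n≡m%n (a * k * x) 1 p ⟨
  (a * k * x + 1 * p) % p    ≡⟨ cong (_% p) (trans (expand a k x) (cong (λ t → suc (t * k)) 1+ax≡bp)) ⟩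
  suc (b * p * k) % p        ≡⟨ cong (_% p) (regroup b k) ⟩
  (1 + b * k * p) % p        ≡⟨ [m+kn]%n≡m%n 1 (b * k) p ⟩
  1 % p                      ∎)
  where
  open ≡-Reasoning
  expand : ∀ a k x → a * k * x + 1 * suc k ≡ suc ((1 + a * x) * k)
  expand = solve 3 (λ a k x →
    a :* k :* x :+ con 1 :* (con 1 :+ k) := con 1 :+ (con 1 :+ a :* x) :* k) refl
  regroup : ∀ b k → suc (b * suc k * k) ≡ 1 + b * k * suc k
  regroup = solve 2 (λ b k →
    con 1 :+ b :* (con 1 :+ k) :* k := con 1 :+ b :* k :* (con 1 :+ k)) refl

-- The inverse of a nonzero square is a square: if u·x ≡ 1 and x ≡ y², then
-- q = u²·x satisfies q·x ≡ (u·x)² ≡ 1 and q ≡ (u·y)².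
square-inverse-square : ∀ p .{{_ : NonZero p}} → Prime p → ∀ x → 0 < x → x < p →
  IsSquare p x → HasSquareInverse p x
square-inverse-square p p-prime x 0<x x<p (y , y²≡x)
  with inverse-mod-prime p p-prime x 0<x x<p
... | u , ux≡1 = u * u * x , qx≡1 , (u * y , uy²≡q)
  where
  qx≡1 : CongMod p (u * u * x * x) 1
  qx≡1 = trans (cong (_% p) (square-of-product u x)) (*-cong-mod p ux≡1 ux≡1)
    where
    square-of-product : ∀ u x → u * u * x * x ≡ (u * x) * (u * x)
    square-of-product = solve 2 (λ u x → u :* u :* x :* x := (u :* x) :* (u :* x)) refl
  uy²≡q : CongMod p ((u * y) * (u * y)) (u * u * x)
  uy²≡q = trans (cong (_% p) (regroup u y)) (*-congˡ-mod p (u * u) y²≡x)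
    where
    regroup : ∀ u y → (u * y) * (u * y) ≡ u * u * (y * y)
    regroup = solve 2 (λ u y → (u :* y) :* (u :* y) := u :* u :* (y :* y)) refl

quotient-step-up : ∀ p .{{_ : NonZero p}} x → HasSquareInverse p x → QuotientIsSquare p 1 0 x 0
quotient-step-up p x (q , qx≡1 , q-square) =
  q , trans (cong (_% p) (+-identityʳ (q * x)))
        (trans qx≡1 (cong (λ t → (t + 1) % p) (sym (*-zeroʳ q)))) , q-square

quotient-step-down : ∀ p .{{_ : NonZero p}} x → HasSquareInverse p x → QuotientIsSquare p 0 1 0 x
quotient-step-down p x (q , qx≡1 , q-square) =
  q , trans (cong (λ t → (t + 1) % p) (*-zeroʳ q))
        (trans (sym qx≡1) (cong (_% p) (sym (+-identityʳ (q * x))))) , q-square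

quotient-flat : ∀ p .{{_ : NonZero p}} x y → QuotientIsSquare p 1 1 x y
quotient-flat p x y = 0 , refl , (0 , refl)

step : ∀ {L} → Fin (suc L) → ℕ
step fzero    = 0
step (fsuc _) = 1

module StepMap (p : ℕ) .{{_ : NonZero p}} (1<p : 1 < p) (L : ℕ) where

  step<p : ∀ (x : Fin (suc L)) → step x < p
  step<p fzero    = ≤-trans (s≤s z≤n) 1<p
  step<p (fsuc _) = 1<p

  stepₚ : Fin (suc L) → Fin p
  stepₚ x = fromℕ< (step<p x)

  toℕ-stepₚ : ∀ x → toℕ (stepₚ x) ≡ step x
  toℕ-stepₚ x = toℕ-fromℕ< (step<p x)

  stepₚ-admissible : Prime p → L < p → (∀ m → 1 ≤ m → m ≤ L → IsSquare p m) →
    Admissible p L stepₚ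
  stepₚ-admissible p-prime L<p squares = at-zero , at-one , quotients
    where
    inverse-square : ∀ (x : Fin (suc L)) → 0 < toℕ x → HasSquareInverse p (toℕ x)
    inverse-square x 0<x = square-inverse-square p p-prime (toℕ x) 0<x
      (≤-<-trans x≤L L<p) (squares (toℕ x) 0<x x≤L)
      where x≤L = ≤-pred (toℕ<n x)

    at-zero : ∀ x → toℕ x ≡ 0 → toℕ (stepₚ x) ≡ 0
    at-zero fzero    _ = toℕ-stepₚ fzero
    at-zero (fsuc _) ()

    at-one : ∀ x → toℕ x ≡ 1 → toℕ (stepₚ x) ≡ 1
    at-one fzero    ()
    at-one (fsuc x) _ = toℕ-stepₚ (fsuc x)

    step-quotients : ∀ x y → toℕ x ≢ toℕ y →
      QuotientIsSquare p (step x) (step y) (toℕ x) (toℕ y)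
    step-quotients fzero    fzero    x≢y = ⊥-elim (x≢y refl)
    step-quotients (fsuc x) fzero    _   = quotient-step-up p _ (inverse-square (fsuc x) (s≤s z≤n))
    step-quotients fzero    (fsuc y) _   = quotient-step-down p _ (inverse-square (fsuc y) (s≤s z≤n))
    step-quotients (fsuc x) (fsuc y) _   = quotient-flat p _ _

    quotients : ∀ x y → toℕ x ≢ toℕ y →
      QuotientIsSquare p (toℕ (stepₚ x)) (toℕ (stepₚ y)) (toℕ x) (toℕ y)
    quotients x y x≢y =
      subst₂ (λ a b → QuotientIsSquare p a b (toℕ x) (toℕ y))
        (sym (toℕ-stepₚ x)) (sym (toℕ-stepₚ y)) (step-quotients x y x≢y)

not-only-identity : ∀ p .{{_ : NonZero p}} → Prime p → ∀ L → 2 ≤ L → L < p →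
  (∀ m → 1 ≤ m → m ≤ L → IsSquare p m) → ¬ OnlyIdentity p L
not-only-identity p p-prime L@(suc (suc _)) (s≤s (s≤s _)) L<p squares only-id
  with trans (sym (toℕ-stepₚ two)) (only-id stepₚ (stepₚ-admissible p-prime L<p squares) two)
  where
  open StepMap p (≤-<-trans (s≤s z≤n) L<p) L
  two : Fin (suc L)
  two = fsuc (fsuc fzero)
... | ()

lemma3p3 : (p : ℕ) → .{{_ : NonZero p}} → Prime p → p ≢ 2 →
    (n L : ℕ) → IsLeastNonResidue p n → IsLp p L → n ≤ L
lemma3p3 zero          p-prime = ⊥-elim (¬prime[0] p-prime)
lemma3p3 (suc zero)    p-prime = ⊥-elim (¬prime[1] p-prime)
lemma3p3 p@(suc (suc _)) p-prime _ n L (_ , _ , below-n-squares) (2≤L , L≤p-1 , only-id , _)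
  with n ≤? L
... | yes n≤L = n≤L
... | no  n≰L = ⊥-elim (not-only-identity p p-prime L 2≤L (s≤s L≤p-1) squares only-id)
  where
  squares : ∀ m → 1 ≤ m → m ≤ L → IsSquare p m
  squares m 1≤m m≤L = below-n-squares m 1≤m (≤-<-trans m≤L (≰⇒> n≰L))
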